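{- Let $m\ge 1$, let $G$ be a finite simple graph, and let $(u,v_i)$ be a vertex of $K_m\times G$ with $u\in V(K_m)$, $v_i\in V(G)$, and $(m-1)+\deg(v_i)\ge 1$. Then \[ l\big((u,v_i)\big)=\frac{1}{(m-1)+\deg(v_i)}\sum_{v_j\in N_G(v_i)}\frac{\deg(v_i)-\deg(v_j)}{(2m-2)+\deg(v_i)+\deg(v_j)}. \]
   Context: $K_m$ is the complete graph on $m$ vertices. The Cartesian product $F\times H$ has vertex set $V(F)\times V(H)$, with $(u_1,v_1)$ adjacent to $(u_2,v_2)$ iff either $u_1=u_2$ and $v_1v_2\in E(H)$, or $v_1=v_2$ and $u_1u_2\in E(F)$. For a vertex $v$ of positive degree, with neighborhood $N_v$, the leverage centrality is $l(v)=\frac{1}{\deg(v)}\sum_{w\in N_v}\frac{\deg(v)-\deg(w)}{\deg(v)+\deg(w)}$. -}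

module Defs where

open import Data.Bool using (Bool; true; false; _∧_; _∨_; not; if_then_else_)
open import Data.Bool.Properties using (∨-comm)
open import Data.Nat using (ℕ; zero; suc; _+_; _*_)
open import Data.Fin using (Fin; _≟_; combine; remQuot)
open import Data.List using (List; foldr; map)
open import Data.Fin.Base using ()
open import Data.List using (allFin)
open import Data.Product using (_×_; _,_)
open import Data.Integer using (ℤ; +_; _-_)
open import Data.Rational using (ℚ; _/_; 0ℚ) renaming (_+_ to _+ℚ_; _*_ to _*ℚ_)
open import Relation.Nullary using (yes; no; does)
open import Relation.Binary.PropositionalEquality using (_≡_; refl; sym; cong)
open import Data.Empty using (⊥-elim)

eqb : ∀ {n} → Fin n → Fin n → Bool
eqb i j = does (i ≟ j)

eqb-refl : ∀ {n} (i : Fin n) → eqb i i ≡ true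
eqb-refl i with i ≟ i
... | yes _ = refl
... | no ¬p = ⊥-elim (¬p refl)

eqb-sym : ∀ {n} (i j : Fin n) → eqb i j ≡ eqb j i
eqb-sym i j with i ≟ j | j ≟ i
... | yes _ | yes _ = refl
... | no _ | no _ = refl
... | yes p | no ¬q = ⊥-elim (¬q (sym p))
... | no ¬p | yes q = ⊥-elim (¬p (sym q))

record SimpleGraph (n : ℕ) : Set where
  field
    adj    : Fin n → Fin n → Bool
    adjSym : ∀ v w → adj v w ≡ adj w v
    adjIrr : ∀ v → adj v v ≡ false
open SimpleGraph public

sumℕ : ∀ {n} → (Fin n → ℕ) → ℕ
sumℕ {n} f = foldr _+_ 0 (map f (allFin n))

sumℚ : ∀ {n} → (Fin n → ℚ) → ℚ
sumℚ {n} f = foldr _+ℚ_ 0ℚ (map f (allFin n))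

deg : ∀ {n} → SimpleGraph n → Fin n → ℕ
deg G v = sumℕ (λ w → if adj G v w then 1 else 0)

sumN : ∀ {n} → SimpleGraph n → Fin n → (Fin n → ℚ) → ℚ
sumN G v f = sumℚ (λ w → if adj G v w then f w else 0ℚ)

-- the fraction p / d, with the (never used under the hypotheses) convention p / 0 = 0
frac : ℤ → ℕ → ℚ
frac p zero    = 0ℚ
frac p (suc d) = p / suc d

leverage : ∀ {n} → SimpleGraph n → Fin n → ℚ
leverage G v =
  frac (+ 1) (deg G v) *ℚ
  sumN G v (λ w → frac (+ deg G v - + deg G w) (deg G v + deg G w))

K : (m : ℕ) → SimpleGraph m
K m = record
  { adj = λ i j → not (eqb i j)
  ; adjSym = λ i j → cong not (eqb-sym i j)
  ; adjIrr = λ i → cong not (eqb-refl i)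
  }

-- Cartesian product F × H; vertex (u , v) is encoded as combine u v : Fin (m * n)
prodAdj : ∀ {m n} → SimpleGraph m → SimpleGraph n →
          Fin m × Fin n → Fin m × Fin n → Bool
prodAdj F H (u₁ , v₁) (u₂ , v₂) =
  (eqb u₁ u₂ ∧ adj H v₁ v₂) ∨ (eqb v₁ v₂ ∧ adj F u₁ u₂)

prodAdj-sym : ∀ {m n} (F : SimpleGraph m) (H : SimpleGraph n) p q →
              prodAdj F H p q ≡ prodAdj F H q p
prodAdj-sym F H (u₁ , v₁) (u₂ , v₂)
  rewrite eqb-sym u₁ u₂ | eqb-sym v₁ v₂ | adjSym H v₁ v₂ | adjSym F u₁ u₂ = refl

prodAdj-irr : ∀ {m n} (F : SimpleGraph m) (H : SimpleGraph n) p →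
              prodAdj F H p p ≡ false
prodAdj-irr F H (u , v) rewrite eqb-refl u | eqb-refl v | adjIrr H v | adjIrr F u = refl

_□_ : ∀ {m n} → SimpleGraph m → SimpleGraph n → SimpleGraph (m * n)
_□_ {m} {n} F H = record
  { adj = λ x y → prodAdj F H (remQuot n x) (remQuot n y)
  ; adjSym = λ x y → prodAdj-sym F H (remQuot n x) (remQuot n y)
  ; adjIrr = λ x → prodAdj-irr F H (remQuot n x)
  }

-- In K_m □ G the neighbours of (u , v) are the (a , v) with a ≠ u and the
-- (u , b) with b ∈ N_G(v), and every vertex (a , b) has degree (m-1) + deg b.
-- The neighbours (a , v) therefore have the same degree as (u , v) and
-- contribute nothing, while for a neighbour (u , b) the two summands m-1
-- cancel in the numerator and add up to 2m-2 in the denominator.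
module Submission where

open import Defs
open import Algebra.Bundles using (CommutativeMonoid)
open import Data.Bool using (true; false; _∧_; _∨_; not; if_then_else_)
open import Data.Fin using (Fin; zero; suc; combine; _↑ˡ_; _↑ʳ_; _≟_)
open import Data.Fin.Properties using (remQuot-combine)
open import Data.Integer using (+_; _-_; _⊖_)
import Data.Integer.Properties as ℤ
open import Data.List using (foldr; map; tabulate; allFin)
open import Data.List.Properties using (map-cong)
open import Data.Nat using (ℕ; zero; suc; _+_; _*_; _∸_; _≥_)
import Data.Nat.Properties as ℕ
open import Data.Nat.Tactic.RingSolver using (solve-∀)
open import Data.Rational using (ℚ; 0ℚ) renaming (_+_ to _+ℚ_; _*_ to _*ℚ_)
import Data.Rational.Properties as ℚ
open import Function using (_∘_; id)
open import Relation.Binary.PropositionalEquality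
  using (_≡_; refl; sym; trans; cong; cong₂; module ≡-Reasoning)
open import Relation.Nullary using (yes; no)

eqb⇒≡ : ∀ {n} {i j : Fin n} → eqb i j ≡ true → i ≡ j
eqb⇒≡ {i = i} {j} eq with i ≟ j | eq
... | yes i≡j | _ = i≡j
... | no _    | ()

eqb⇒¬adj : ∀ {n} (G : SimpleGraph n) {v w} → eqb v w ≡ true → adj G v w ≡ false
eqb⇒¬adj G {v} {w} eq with refl ← eqb⇒≡ {i = v} {w} eq = adjIrr G v

adj-□-combine : ∀ {m n} (F : SimpleGraph m) (H : SimpleGraph n) u v a b →
  adj (F □ H) (combine u v) (combine a b) ≡ (eqb u a ∧ adj H v b) ∨ (eqb v b ∧ adj F u a)
adj-□-combine {n = n} F H u v a b =
  cong₂ (prodAdj F H) (remQuot-combine {k = n} u v) (remQuot-combine {k = n} a b)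

module NeighbourhoodSums {c ℓ} (M : CommutativeMonoid c ℓ) where

  open CommutativeMonoid M renaming (refl to ≈-refl; sym to ≈-sym; trans to ≈-trans)
  open import Algebra.Properties.CommutativeMonoid.Sum M public using (sum)
  open import Algebra.Properties.CommutativeMonoid.Sum M hiding (sum)
  open import Relation.Binary.Reasoning.Setoid setoid

  neighbourhoodSum : ∀ {n} → SimpleGraph n → Fin n → (Fin n → Carrier) → Carrier
  neighbourhoodSum {n} G v f = ∑[ w < n ] (if adj G v w then f w else ε)

  foldr-map-tabulate : ∀ {a} {A : Set a} {n} (f : A → Carrier) (g : Fin n → A) →
    foldr _∙_ ε (map f (tabulate g)) ≡ sum (f ∘ g)
  foldr-map-tabulate {n = zero}  f g = refl
  foldr-map-tabulate {n = suc n} f g = cong (f (g zero) ∙_) (foldr-map-tabulate f (g ∘ suc))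

  foldr-map-allFin : ∀ {n} (f : Fin n → Carrier) → foldr _∙_ ε (map f (allFin n)) ≡ sum f
  foldr-map-allFin f = foldr-map-tabulate f id

  sum-↑ : ∀ m {n} (h : Fin (m + n) → Carrier) →
    sum h ≈ sum (h ∘ (_↑ˡ n)) ∙ sum (h ∘ (m ↑ʳ_))
  sum-↑ zero    h = ≈-sym (identityˡ _)
  sum-↑ (suc m) h = ≈-trans (∙-congˡ (sum-↑ m (h ∘ suc))) (≈-sym (assoc _ _ _))

  sum-combine : ∀ m n (h : Fin (m * n) → Carrier) →
    sum h ≈ ∑[ a < m ] ∑[ b < n ] h (combine a b)
  sum-combine zero    n h = ≈-refl
  sum-combine (suc m) n h = ≈-trans (sum-↑ n h) (∙-congˡ (sum-combine m n (h ∘ (n ↑ʳ_))))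

  sum-if : ∀ e {n} (g : Fin n → Carrier) →
    ∑[ i < n ] (if e then g i else ε) ≈ (if e then sum g else ε)
  sum-if true      g = ≈-refl
  sum-if false {n} g = sum-replicate-zero n

  sum-eqb : ∀ {n} (v : Fin n) (g : Fin n → Carrier) →
    ∑[ w < n ] (if eqb v w then g w else ε) ≈ g v
  sum-eqb {suc n} zero    g = ≈-trans (∙-congˡ (sum-replicate-zero n)) (identityʳ _)
  sum-eqb         (suc v) g = ≈-trans (identityˡ _) (sum-eqb v (g ∘ suc))

  if-∨-disjoint : ∀ e p e′ q (x : Carrier) → (e ≡ true → q ≡ false) →
    (if (e ∧ p) ∨ (e′ ∧ q) then x else ε)
      ≈ (if e then (if p then x else ε) else ε) ∙ (if e′ then (if q then x else ε) else ε)
  if-∨-disjoint false p false q     x _ = ≈-sym (identityˡ ε)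
  if-∨-disjoint false p true  false x _ = ≈-sym (identityˡ ε)
  if-∨-disjoint false p true  true  x _ = ≈-sym (identityˡ x)
  if-∨-disjoint true  p e′    q     x e⇒¬q with e⇒¬q refl
  if-∨-disjoint true  true  false false x _ | refl = ≈-sym (identityʳ x)
  if-∨-disjoint true  true  true  false x _ | refl = ≈-sym (identityʳ x)
  if-∨-disjoint true  false false false x _ | refl = ≈-sym (identityˡ ε)
  if-∨-disjoint true  false true  false x _ | refl = ≈-sym (identityˡ ε)

  neighbourhoodSum-□ : ∀ {m n} (F : SimpleGraph m) (H : SimpleGraph n) u v
    (f : Fin (m * n) → Carrier) →
    neighbourhoodSum (F □ H) (combine u v) f
      ≈ neighbourhoodSum F u (λ a → f (combine a v)) ∙ neighbourhoodSum H v (λ b → f (combine u b))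
  neighbourhoodSum-□ {m} {n} F H u v f = begin
    neighbourhoodSum (F □ H) (combine u v) f
      ≈⟨ sum-combine m n _ ⟩
    ∑[ a < m ] ∑[ b < n ] (if adj (F □ H) (combine u v) (combine a b) then f (combine a b) else ε)
      ≈⟨ sum-cong-≋ {m} (λ a → sum-cong-≋ {n} (split a)) ⟩
    ∑[ a < m ] ∑[ b < n ] (alongH a b ∙ alongF a b)
      ≈⟨ sum-cong-≋ {m} (λ a → ∑-distrib-+ (alongH a) (alongF a)) ⟩
    ∑[ a < m ] (∑[ b < n ] alongH a b ∙ ∑[ b < n ] alongF a b)
      ≈⟨ ∑-distrib-+ (λ a → ∑[ b < n ] alongH a b) (λ a → ∑[ b < n ] alongF a b) ⟩
    ∑[ a < m ] ∑[ b < n ] alongH a b ∙ ∑[ a < m ] ∑[ b < n ] alongF a b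
      ≈⟨ ∙-cong (≈-trans (sum-cong-≋ {m} (λ a → sum-if (eqb u a) (viaH a))) (sum-eqb u (sum ∘ viaH)))
                (sum-cong-≋ {m} (λ a → sum-eqb v (viaF a))) ⟩
    neighbourhoodSum H v (λ b → f (combine u b)) ∙ neighbourhoodSum F u (λ a → f (combine a v))
      ≈⟨ comm _ _ ⟩
    neighbourhoodSum F u (λ a → f (combine a v)) ∙ neighbourhoodSum H v (λ b → f (combine u b)) ∎
    where
    viaH viaF alongH alongF : Fin m → Fin n → Carrier
    viaH a b = if adj H v b then f (combine a b) else ε
    viaF a b = if adj F u a then f (combine a b) else ε
    alongH a b = if eqb u a then viaH a b else ε
    alongF a b = if eqb v b then viaF a b else ε

    split : ∀ a b →
      (if adj (F □ H) (combine u v) (combine a b) then f (combine a b) else ε)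
        ≈ alongH a b ∙ alongF a b
    split a b = begin
      (if adj (F □ H) (combine u v) (combine a b) then f (combine a b) else ε)
        ≡⟨ cong (if_then f (combine a b) else ε) (adj-□-combine F H u v a b) ⟩
      (if (eqb u a ∧ adj H v b) ∨ (eqb v b ∧ adj F u a) then f (combine a b) else ε)
        ≈⟨ if-∨-disjoint (eqb u a) _ (eqb v b) _ _ (eqb⇒¬adj F) ⟩
      alongH a b ∙ alongF a b ∎

  neighbourhoodSum-zero : ∀ {n} (G : SimpleGraph n) v {f : Fin n → Carrier} →
    (∀ w → f w ≈ ε) → neighbourhoodSum G v f ≈ ε
  neighbourhoodSum-zero {n} G v {f} f≈ε =
    ≈-trans (sum-cong-≋ {n} vanishes) (sum-replicate-zero n)
    where
    vanishes : ∀ w → (if adj G v w then f w else ε) ≈ ε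
    vanishes w with adj G v w
    ... | true  = f≈ε w
    ... | false = ≈-refl

module ℕΣ = NeighbourhoodSums ℕ.+-0-commutativeMonoid
module ℚΣ = NeighbourhoodSums ℚ.+-0-commutativeMonoid

deg≡neighbourhoodSum : ∀ {n} (G : SimpleGraph n) v → deg G v ≡ ℕΣ.neighbourhoodSum G v (λ _ → 1)
deg≡neighbourhoodSum G v = ℕΣ.foldr-map-allFin (λ w → if adj G v w then 1 else 0)

sumN≡neighbourhoodSum : ∀ {n} (G : SimpleGraph n) v f → sumN G v f ≡ ℚΣ.neighbourhoodSum G v f
sumN≡neighbourhoodSum G v f = ℚΣ.foldr-map-allFin (λ w → if adj G v w then f w else 0ℚ)

deg-□ : ∀ {m n} (F : SimpleGraph m) (H : SimpleGraph n) u v →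
  deg (F □ H) (combine u v) ≡ deg F u + deg H v
deg-□ F H u v = begin
  deg (F □ H) (combine u v)
    ≡⟨ deg≡neighbourhoodSum (F □ H) _ ⟩
  ℕΣ.neighbourhoodSum (F □ H) (combine u v) (λ _ → 1)
    ≡⟨ ℕΣ.neighbourhoodSum-□ F H u v (λ _ → 1) ⟩
  ℕΣ.neighbourhoodSum F u (λ _ → 1) + ℕΣ.neighbourhoodSum H v (λ _ → 1)
    ≡⟨ sym (cong₂ _+_ (deg≡neighbourhoodSum F u) (deg≡neighbourhoodSum H v)) ⟩
  deg F u + deg H v ∎
  where open ≡-Reasoning

sumN-□ : ∀ {m n} (F : SimpleGraph m) (H : SimpleGraph n) u v (f : Fin (m * n) → ℚ) →
  sumN (F □ H) (combine u v) f
    ≡ sumN F u (λ a → f (combine a v)) +ℚ sumN H v (λ b → f (combine u b))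
sumN-□ F H u v f = begin
  sumN (F □ H) (combine u v) f
    ≡⟨ sumN≡neighbourhoodSum (F □ H) _ f ⟩
  ℚΣ.neighbourhoodSum (F □ H) (combine u v) f
    ≡⟨ ℚΣ.neighbourhoodSum-□ F H u v f ⟩
  ℚΣ.neighbourhoodSum F u f∘[-,v] +ℚ ℚΣ.neighbourhoodSum H v f∘[u,-]
    ≡⟨ sym (cong₂ _+ℚ_ (sumN≡neighbourhoodSum F u f∘[-,v]) (sumN≡neighbourhoodSum H v f∘[u,-])) ⟩
  sumN F u f∘[-,v] +ℚ sumN H v f∘[u,-] ∎
  where
  open ≡-Reasoning
  f∘[-,v] = λ a → f (combine a v)
  f∘[u,-] = λ b → f (combine u b)

sumN-zero : ∀ {n} (G : SimpleGraph n) v {f : Fin n → ℚ} → (∀ w → f w ≡ 0ℚ) → sumN G v f ≡ 0ℚ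
sumN-zero G v f≡0 = trans (sumN≡neighbourhoodSum G v _) (ℚΣ.neighbourhoodSum-zero G v f≡0)

sumN-cong : ∀ {n} (G : SimpleGraph n) v {f g : Fin n → ℚ} → (∀ w → f w ≡ g w) →
  sumN G v f ≡ sumN G v g
sumN-cong G v f≡g =
  cong (foldr _+ℚ_ 0ℚ) (map-cong (λ w → cong (if adj G v w then_else 0ℚ) (f≡g w)) (allFin _))

sum-const-1 : ∀ n → ℕΣ.sum {n} (λ _ → 1) ≡ n
sum-const-1 zero    = refl
sum-const-1 (suc n) = cong suc (sum-const-1 n)

deg-K : ∀ {m} (u : Fin m) → deg (K m) u ≡ m ∸ 1
deg-K u = trans (deg≡neighbourhoodSum (K _) u) (count-≢ u)
  where
  count-≢ : ∀ {m} (u : Fin m) → ℕΣ.sum (λ a → if not (eqb u a) then 1 else 0) ≡ m ∸ 1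
  count-≢ {suc m}       zero    = sum-const-1 m
  count-≢ {suc (suc m)} (suc u) = cong suc (count-≢ u)

deg-K□ : ∀ {k n} (G : SimpleGraph n) (a : Fin (suc k)) b →
  deg (K (suc k) □ G) (combine a b) ≡ k + deg G b
deg-K□ G a b = trans (deg-□ (K _) G a b) (cong (_+ deg G _) (deg-K a))

leverageTerm : ℕ → ℕ → ℚ
leverageTerm d e = frac (+ d - + e) (d + e)

leverageTerm-diag : ∀ d → leverageTerm d d ≡ 0ℚ
leverageTerm-diag d rewrite ℤ.+-inverseʳ (+ d) with d + d
... | zero  = refl
... | suc s = ℚ.0/n≡0 (suc s)

[+m]-[+n]-cancelˡ : ∀ k m n → + (k + m) - + (k + n) ≡ + m - + n
[+m]-[+n]-cancelˡ k m n = begin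
  + (k + m) - + (k + n)  ≡⟨ ℤ.[+m]-[+n]≡m⊖n (k + m) (k + n) ⟩
  (k + m) ⊖ (k + n)      ≡⟨ ℤ.+-cancelˡ-⊖ k m n ⟩
  m ⊖ n                  ≡⟨ sym (ℤ.[+m]-[+n]≡m⊖n m n) ⟩
  + m - + n              ∎
  where open ≡-Reasoning

leverageTerm-shift : ∀ k d e →
  leverageTerm (k + d) (k + e) ≡ frac (+ d - + e) ((2 * suc k ∸ 2) + d + e)
leverageTerm-shift k d e = cong₂ frac ([+m]-[+n]-cancelˡ k d e) (begin
  (k + d) + (k + e)         ≡⟨ regroup k d e ⟩
  2 * k + d + e             ≡⟨ cong (λ t → t + d + e) (ℕ.*-distribˡ-∸ 2 (suc k) 1) ⟩
  (2 * suc k ∸ 2) + d + e   ∎)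
  where
  open ≡-Reasoning
  regroup : ∀ k d e → (k + d) + (k + e) ≡ 2 * k + d + e
  regroup = solve-∀

mainTheorem5 : (m n : ℕ) → m ≥ 1 → (G : SimpleGraph n) → (u : Fin m) → (vi : Fin n) →
    (m ∸ 1) + deg G vi ≥ 1 →
    leverage (K m □ G) (combine u vi)
      ≡ frac (+ 1) ((m ∸ 1) + deg G vi)
        *ℚ sumN G vi (λ vj → frac (+ deg G vi - + deg G vj) ((2 * m ∸ 2) + deg G vi + deg G vj))
mainTheorem5 (suc k) n _ G u v _ =
  cong₂ _*ℚ_ (cong (frac (+ 1)) (deg-K□ G u v)) (begin
    sumN (K m □ G) (combine u v) (λ w → leverageTerm (D (combine u v)) (D w))
      ≡⟨ sumN-□ (K m) G u v (leverageTerm (D (combine u v)) ∘ D) ⟩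
    sumN (K m) u (λ a → leverageTerm (D (combine u v)) (D (combine a v)))
      +ℚ sumN G v (λ b → leverageTerm (D (combine u v)) (D (combine u b)))
      ≡⟨ cong₂ _+ℚ_ (sumN-zero (K m) u alongK) (sumN-cong G v alongG) ⟩
    0ℚ +ℚ sumN G v _
      ≡⟨ ℚ.+-identityˡ _ ⟩
    sumN G v (λ b → frac (+ deg G v - + deg G b) ((2 * m ∸ 2) + deg G v + deg G b)) ∎)
  where
  open ≡-Reasoning
  m = suc k
  D = deg (K m □ G)
  alongK : ∀ a → leverageTerm (D (combine u v)) (D (combine a v)) ≡ 0ℚ
  alongK a = trans (cong₂ leverageTerm (deg-K□ G u v) (deg-K□ G a v)) (leverageTerm-diag (k + deg G v))
  alongG : ∀ b → leverageTerm (D (combine u v)) (D (combine u b))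
                   ≡ frac (+ deg G v - + deg G b) ((2 * m ∸ 2) + deg G v + deg G b)
  alongG b = trans (cong₂ leverageTerm (deg-K□ G u v) (deg-K□ G u b)) (leverageTerm-shift k _ _)
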